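{- Let $n\ge 3$ and let $C_n$ be the cycle on $n$ vertices. Then \[Z_{(\ell)}(C_n) = \begin{cases} 2 & \text{if } \ell \in\{0,1\},\\ n & \text{if } \ell \ge 2.\end{cases}\]
   Context: Let $G=(V,E)$ be a finite simple graph. Color-change rule (zero forcing): given a set of colored vertices, a colored vertex with exactly one uncolored neighbor colors ("forces") that neighbor. Leaks: for a set $L\subseteq V$, placing a leak on each $v\in L$ means attaching to $v$ one new pendant vertex (adjacent only to $v$) which is never initially colored; consequently no vertex of $L$ can ever force a vertex of $V$. A set $S\subseteq V$ is an $\ell$-forcing set if for every $L\subseteq V$ with $|L|\le \ell$, starting with exactly the vertices of $S$ colored and repeatedly applying the color-change rule in the graph with leaks on $L$, every vertex of $V$ eventually becomes colored. $Z_{(\ell)}(G)$ ($\ell\ge0$ an integer) is the minimum size of an $\ell$-forcing set. -}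

module Defs where

open import Data.Nat using (ℕ; zero; suc; _≤_)
open import Data.Fin using (Fin; toℕ)
open import Data.Fin.Subset using (Subset; _∈_; _∉_; ∣_∣)
open import Data.Product using (Σ; _×_; _,_)
open import Data.Sum using (_⊎_)
open import Relation.Binary.PropositionalEquality using (_≡_; _≢_)
open import Relation.Nullary using (¬_)

record Graph (n : ℕ) : Set₁ where
  field
    Adj     : Fin n → Fin n → Set
    symAdj  : ∀ {u v} → Adj u v → Adj v u
    irrefl  : ∀ {u} → ¬ Adj u u
open Graph public

-- A vertex u that is coloured, is not leaked, and all of whose neighbours
-- other than w are coloured, forces its neighbour w.
-- (A leak at u = a pendant never initially coloured, so u can never force
-- a vertex of V; forcing of the pendant itself is irrelevant.)
data Colored {n : ℕ} (G : Graph n) (L S : Subset n) : Fin n → Set where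
  init  : ∀ {v} → v ∈ S → Colored G L S v
  force : ∀ {u w} → u ∉ L → Colored G L S u → Adj G u w →
          (∀ x → Adj G u x → x ≢ w → Colored G L S x) →
          Colored G L S w

IsLForcingSet : {n : ℕ} → Graph n → ℕ → Subset n → Set
IsLForcingSet {n} G ℓ S = (L : Subset n) → ∣ L ∣ ≤ ℓ → (v : Fin n) → Colored G L S v

ZeroForcingℓ≡ : {n : ℕ} → Graph n → ℕ → ℕ → Set
ZeroForcingℓ≡ {n} G ℓ k =
  (Σ (Subset n) λ S → IsLForcingSet G ℓ S × ∣ S ∣ ≡ k) ×
  ((S : Subset n) → IsLForcingSet G ℓ S → k ≤ ∣ S ∣)

CycStep : (n : ℕ) → Fin n → Fin n → Set
CycStep n i j = (toℕ j ≡ suc (toℕ i)) ⊎ ((suc (toℕ i) ≡ n) × (toℕ j ≡ 0))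

CycAdj : (n : ℕ) → Fin n → Fin n → Set
CycAdj n i j = (CycStep n i j ⊎ CycStep n j i) × (i ≢ j)

Cycle : (n : ℕ) → Graph n
Cycle n = record
  { Adj = CycAdj n
  ; symAdj = λ { (Data.Sum.inj₁ a , ne) → Data.Sum.inj₂ a , (λ e → ne (Relation.Binary.PropositionalEquality.sym e))
               ; (Data.Sum.inj₂ a , ne) → Data.Sum.inj₁ a , (λ e → ne (Relation.Binary.PropositionalEquality.sym e)) }
  ; irrefl = λ { (_ , ne) → ne Relation.Binary.PropositionalEquality.refl }
  }

-- With at most one leak,
-- colouring two adjacent vertices 0, 1 starts two waves of forces, one running
-- forward 1 → 2 → … and one backward 0 → n-1 → n-2 → …, and a single leak
-- cannot block both routes to a given vertex. Conversely a single coloured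
-- vertex never forces (its two neighbours cannot both be coloured), and with
-- two leaks on the neighbours of an uncoloured vertex nothing can ever force
-- it, so every vertex must be coloured initially.
module Submission where

open import Defs
open import Data.Nat using (ℕ; zero; suc; _+_; _≤_; _<_; _≥_; z≤n; s≤s; z<s; s<s; _<?_; _≤?_)
open import Data.Nat.Properties
open import Data.Nat.GeneralisedArithmetic using (iterate)
open import Data.Fin as Fin using (Fin; toℕ; fromℕ; fromℕ<; inject₁)
open import Data.Fin.Properties using (toℕ-injective; toℕ-fromℕ<; toℕ-fromℕ; toℕ-inject₁; toℕ<n; any?)
  renaming (_≟_ to _≟ᶠ_)
open import Data.Fin.Subset using (Subset; _∈_; _∉_; ∣_∣; ⊤; ⊥; ⁅_⁆; _∪_; inside; outside)
open import Data.Fin.Subset.Properties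
open import Data.Product using (∃; ∃₂; _×_; _,_; proj₁; proj₂)
open import Data.Sum using (_⊎_; inj₁; inj₂; swap)
open import Data.Vec using (_∷_; [])
open import Function using (_∘_)
open import Relation.Nullary using (¬_; yes; no; contradiction)
open import Relation.Nullary.Decidable using (_×-dec_)
open import Relation.Unary using (Decidable)
open import Relation.Binary.PropositionalEquality

∣p∪q∣≤∣p∣+∣q∣ : ∀ {n} (p q : Subset n) → ∣ p ∪ q ∣ ≤ ∣ p ∣ + ∣ q ∣
∣p∪q∣≤∣p∣+∣q∣ [] [] = z≤n
∣p∪q∣≤∣p∣+∣q∣ (inside ∷ p) (x ∷ q) =
  s≤s (≤-trans (∣p∪q∣≤∣p∣+∣q∣ p q) (+-monoʳ-≤ ∣ p ∣ (∣p∣≤∣x∷p∣ x q)))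
∣p∪q∣≤∣p∣+∣q∣ (outside ∷ p) (inside ∷ q) rewrite +-suc ∣ p ∣ ∣ q ∣ = s≤s (∣p∪q∣≤∣p∣+∣q∣ p q)
∣p∪q∣≤∣p∣+∣q∣ (outside ∷ p) (outside ∷ q) = ∣p∪q∣≤∣p∣+∣q∣ p q

module _ {n : ℕ} where

  ∣⁅x⁆∪⁅y⁆∣≤2 : (x y : Fin n) → ∣ ⁅ x ⁆ ∪ ⁅ y ⁆ ∣ ≤ 2
  ∣⁅x⁆∪⁅y⁆∣≤2 x y = ≤-trans (∣p∪q∣≤∣p∣+∣q∣ ⁅ x ⁆ ⁅ y ⁆)
    (≤-reflexive (cong₂ _+_ (∣⁅x⁆∣≡1 x) (∣⁅x⁆∣≡1 y)))

  x≢y⇒2≤∣p∣ : ∀ {p : Subset n} {x y} → x ∈ p → y ∈ p → x ≢ y → 2 ≤ ∣ p ∣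
  x≢y⇒2≤∣p∣ x∈p y∈p x≢y = ≤-trans (s≤s z<s)
    (≤-trans (s≤s (x∈p⇒∣p-x∣<∣p∣ (x∈p∧x≢y⇒x∈p-y y∈p (x≢y ∘ sym)))) (x∈p⇒∣p-x∣<∣p∣ x∈p))

  ∣p∣≤1⇒x≡y : ∀ {p : Subset n} {x y} → ∣ p ∣ ≤ 1 → x ∈ p → y ∈ p → x ≡ y
  ∣p∣≤1⇒x≡y {x = x} {y} ∣p∣≤1 x∈p y∈p with x ≟ᶠ y
  ... | yes x≡y = x≡y
  ... | no x≢y = contradiction (≤-trans (x≢y⇒2≤∣p∣ x∈p y∈p x≢y) ∣p∣≤1) 1+n≰n

  ∣p∣≤1⇒∀¬P⊎∀P : ∀ {p : Subset n} {P : Fin n → Set} → Decidable P → ∣ p ∣ ≤ 1 →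
                 (∀ {x} → x ∈ p → ¬ P x) ⊎ (∀ {x} → x ∈ p → P x)
  ∣p∣≤1⇒∀¬P⊎∀P {p} {P} P? ∣p∣≤1 with any? (λ x → (x ∈? p) ×-dec P? x)
  ... | yes (x , x∈p , Px) = inj₂ λ y∈p → subst P (∣p∣≤1⇒x≡y ∣p∣≤1 x∈p y∈p) Px
  ... | no ¬∃ = inj₁ λ x∈p Px → ¬∃ (_ , x∈p , Px)

module _ {n : ℕ} (G : Graph n) where

  TwoNeighbours : Set
  TwoNeighbours = ∀ u → ∃₂ λ a b → Adj G u a × Adj G u b × a ≢ b

  neighbour-other-than : TwoNeighbours → ∀ u w → ∃ λ x → Adj G u x × x ≢ w
  neighbour-other-than two u w with two u
  ... | a , b , u~a , u~b , a≢b with a ≟ᶠ w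
  ...   | yes refl = b , u~b , a≢b ∘ sym
  ...   | no a≢w = a , u~a , a≢w

  module _ {L S : Subset n} where

    Colored⇒∈-if-neighbours-leaked : ∀ {v} → (∀ {u} → Adj G v u → u ∈ L) →
                                     Colored G L S v → v ∈ S
    Colored⇒∈-if-neighbours-leaked _ (init v∈S) = v∈S
    Colored⇒∈-if-neighbours-leaked leaked (force u∉L _ u~v _) = contradiction (leaked (symAdj G u~v)) u∉L

    Colored⇒∈-if-subsingleton : TwoNeighbours → (∀ {x y} → x ∈ S → y ∈ S → x ≡ y) →
                                ∀ {w} → Colored G L S w → w ∈ S
    Colored⇒∈-if-subsingleton _ _ (init w∈S) = w∈S
    Colored⇒∈-if-subsingleton two single (force {u} {w} _ u-col u~w others)
      with neighbour-other-than two u w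
    ... | x , u~x , x≢w = contradiction (subst (Adj G u) (single x∈S u∈S) u~x) (irrefl G)
      where
      u∈S : u ∈ S
      u∈S = Colored⇒∈-if-subsingleton two single u-col
      x∈S : x ∈ S
      x∈S = Colored⇒∈-if-subsingleton two single (others x u~x x≢w)

  2≤∣forcing-set∣ : TwoNeighbours → ∀ {x y : Fin n} → x ≢ y →
                    ∀ {ℓ S} → IsLForcingSet G ℓ S → 2 ≤ ∣ S ∣
  2≤∣forcing-set∣ two {x} {y} x≢y {S = S} forcing with 2 ≤? ∣ S ∣
  ... | yes 2≤∣S∣ = 2≤∣S∣
  ... | no 2≰∣S∣ = contradiction (single (colored x) (colored y)) x≢y
    where
    single : ∀ {x y} → x ∈ S → y ∈ S → x ≡ y
    single = ∣p∣≤1⇒x≡y (≤-pred (≰⇒> 2≰∣S∣))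
    colored : ∀ v → v ∈ S
    colored v = Colored⇒∈-if-subsingleton two single
      (forcing ⊥ (≤-trans (≤-reflexive (∣⊥∣≡0 n)) z≤n) v)

  Z≡n-if-neighbourhoods-≤ℓ : ∀ {ℓ} → (∀ v → ∃ λ N → ∣ N ∣ ≤ ℓ × (∀ {u} → Adj G v u → u ∈ N)) →
                             ZeroForcingℓ≡ G ℓ n
  Z≡n-if-neighbourhoods-≤ℓ neighbourhood =
    (⊤ , (λ _ _ _ → init ∈⊤) , ∣⊤∣≡n n) ,
    λ S forcing → subst (_≤ ∣ S ∣) (∣⊤∣≡n n) (p⊆q⇒∣p∣≤∣q∣ {p = ⊤} (λ {v} _ → colored forcing v))
    where
    colored : ∀ {S} → IsLForcingSet G _ S → ∀ v → v ∈ S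
    colored forcing v with neighbourhood v
    ... | N , ∣N∣≤ℓ , ⊆N = Colored⇒∈-if-neighbours-leaked ⊆N (forcing N ∣N∣≤ℓ v)

  module _ {L S : Subset n} (succ pred : Fin n → Fin n)
           (adj-succ : ∀ u → Adj G u (succ u))
           (adj⇒succ⊎pred : ∀ {u x} → Adj G u x → x ≡ succ u ⊎ x ≡ pred u)
           (pred∘succ : ∀ u → pred (succ u) ≡ u) where

    Colored-succ : ∀ {u} → u ∉ L → Colored G L S (pred u) → Colored G L S u →
                   Colored G L S (succ u)
    Colored-succ {u} u∉L pred-col u-col = force u∉L u-col (adj-succ u) others
      where
      others : ∀ x → Adj G u x → x ≢ succ u → Colored G L S x
      others x u~x x≢succ with adj⇒succ⊎pred u~x
      ... | inj₁ x≡succ = contradiction x≡succ x≢succ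
      ... | inj₂ refl = pred-col

    Colored-iterate : ∀ k {u} → Colored G L S (pred u) → Colored G L S u →
                      (∀ {i} → i < k → iterate succ u i ∉ L) → Colored G L S (iterate succ u k)
    Colored-iterate zero _ u-col _ = u-col
    Colored-iterate (suc k) {u} pred-col u-col unleaked =
      Colored-iterate k (subst (Colored G L S) (sym (pred∘succ u)) u-col)
        (Colored-succ (unleaked z<s) pred-col u-col) (unleaked ∘ s<s)

module _ {n : ℕ} where

  CycStep-functional : ∀ {u x y} → CycStep n u x → CycStep n u y → x ≡ y
  CycStep-functional {u} {x} {y} s t = toℕ-injective (go s t)
    where
    go : CycStep n u x → CycStep n u y → toℕ x ≡ toℕ y
    go (inj₁ p) (inj₁ q) = trans p (sym q)
    go (inj₁ p) (inj₂ (q , _)) = contradiction (subst (_< n) (trans p q) (toℕ<n x)) (<-irrefl refl)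
    go (inj₂ (q , _)) (inj₁ p) = contradiction (subst (_< n) (trans p q) (toℕ<n y)) (<-irrefl refl)
    go (inj₂ (_ , p)) (inj₂ (_ , q)) = trans p (sym q)

  CycStep-injective : ∀ {x y u} → CycStep n x u → CycStep n y u → x ≡ y
  CycStep-injective {x} {y} s t = toℕ-injective (go s t)
    where
    go : CycStep n x _ → CycStep n y _ → toℕ x ≡ toℕ y
    go (inj₁ p) (inj₁ q) = suc-injective (trans (sym p) q)
    go (inj₁ p) (inj₂ (_ , q)) with trans (sym q) p
    ... | ()
    go (inj₂ (_ , q)) (inj₁ p) with trans (sym q) p
    ... | ()
    go (inj₂ (p , _)) (inj₂ (q , _)) = suc-injective (trans p (sym q))

  CycStep-both-ways⇒n≤2 : ∀ {u x} → CycStep n u x → CycStep n x u → n ≤ 2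
  CycStep-both-ways⇒n≤2 {u} (inj₁ p) (inj₁ q) = contradiction (trans q (cong suc p)) (m≢1+n+m (toℕ u) {1})
  CycStep-both-ways⇒n≤2 (inj₁ p) (inj₂ (q , r)) = ≤-reflexive (trans (sym q) (cong suc (trans p (cong suc r))))
  CycStep-both-ways⇒n≤2 (inj₂ (q , r)) (inj₁ p) = ≤-reflexive (trans (sym q) (cong suc (trans p (cong suc r))))
  CycStep-both-ways⇒n≤2 (inj₂ (_ , r)) (inj₂ (q , _)) = ≤-trans (≤-reflexive (trans (sym q) (cong suc r))) (s≤s z≤n)

  toℕ-CycStep : ∀ {u x} → CycStep n u x → suc (toℕ u) < n → toℕ x ≡ suc (toℕ u)
  toℕ-CycStep (inj₁ p) _ = p
  toℕ-CycStep (inj₂ (q , _)) lt = contradiction (subst (_< n) q lt) (<-irrefl refl)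

  toℕ-CycStep⁻ : ∀ {x u} → CycStep n x u → 0 < toℕ u → suc (toℕ x) ≡ toℕ u
  toℕ-CycStep⁻ (inj₁ p) _ = sym p
  toℕ-CycStep⁻ (inj₂ (_ , q)) lt = contradiction (subst (0 <_) q lt) (<-irrefl refl)

module _ {m : ℕ} where

  CycStep⇒≢ : ∀ {u x} → CycStep (2 + m) u x → u ≢ x
  CycStep⇒≢ (inj₁ p) refl = m≢1+n+m _ {0} p
  CycStep⇒≢ (inj₂ (p , q)) refl with trans (sym (cong suc q)) p
  ... | ()

  successor : (u : Fin (2 + m)) → ∃ (CycStep (2 + m) u)
  successor u with suc (toℕ u) <? 2 + m
  ... | yes lt = fromℕ< lt , inj₁ (toℕ-fromℕ< lt)
  ... | no ¬lt = Fin.zero , inj₂ (≤-antisym (toℕ<n u) (≮⇒≥ ¬lt) , refl)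

  predecessor : (u : Fin (2 + m)) → ∃ λ x → CycStep (2 + m) x u
  predecessor Fin.zero = fromℕ (suc m) , inj₂ (cong suc (toℕ-fromℕ (suc m)) , refl)
  predecessor (Fin.suc u) = inject₁ u , inj₁ (cong suc (sym (toℕ-inject₁ u)))

  next prev : Fin (2 + m) → Fin (2 + m)
  next = proj₁ ∘ successor
  prev = proj₁ ∘ predecessor

  adj-next : ∀ u → CycAdj (2 + m) u (next u)
  adj-next u = inj₁ (proj₂ (successor u)) , CycStep⇒≢ (proj₂ (successor u))

  adj-prev : ∀ u → CycAdj (2 + m) u (prev u)
  adj-prev u = inj₂ (proj₂ (predecessor u)) , CycStep⇒≢ (proj₂ (predecessor u)) ∘ sym

  adj⇒next⊎prev : ∀ {u x} → CycAdj (2 + m) u x → x ≡ next u ⊎ x ≡ prev u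
  adj⇒next⊎prev {u} (inj₁ s , _) = inj₁ (CycStep-functional s (proj₂ (successor u)))
  adj⇒next⊎prev {u} (inj₂ s , _) = inj₂ (CycStep-injective s (proj₂ (predecessor u)))

  adj⇒prev⊎next : ∀ {u x} → CycAdj (2 + m) u x → x ≡ prev u ⊎ x ≡ next u
  adj⇒prev⊎next = swap ∘ adj⇒next⊎prev

  adj⇒∈⁅next⁆∪⁅prev⁆ : ∀ {u x} → CycAdj (2 + m) u x → x ∈ ⁅ next u ⁆ ∪ ⁅ prev u ⁆
  adj⇒∈⁅next⁆∪⁅prev⁆ {u} u~x with adj⇒next⊎prev u~x
  ... | inj₁ refl = x∈p∪q⁺ (inj₁ (x∈⁅x⁆ (next u)))
  ... | inj₂ refl = x∈p∪q⁺ (inj₂ (x∈⁅x⁆ (prev u)))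

  prev∘next : ∀ u → prev (next u) ≡ u
  prev∘next u = CycStep-injective (proj₂ (predecessor (next u))) (proj₂ (successor u))

  next∘prev : ∀ u → next (prev u) ≡ u
  next∘prev u = CycStep-functional (proj₂ (successor (prev u))) (proj₂ (predecessor u))

  next≢prev : 3 ≤ 2 + m → ∀ u → next u ≢ prev u
  next≢prev 3≤n u next≡prev = contradiction (≤-trans 3≤n (CycStep-both-ways⇒n≤2 step step⁻)) 1+n≰n
    where
    step = proj₂ (successor u)
    step⁻ = subst (λ x → CycStep (2 + m) x u) (sym next≡prev) (proj₂ (predecessor u))

  cycle-two-neighbours : 3 ≤ 2 + m → TwoNeighbours (Cycle (2 + m))
  cycle-two-neighbours 3≤n u = next u , prev u , adj-next u , adj-prev u , next≢prev 3≤n u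

  toℕ-iterate-next : ∀ i u → toℕ u + i < 2 + m → toℕ (iterate next u i) ≡ toℕ u + i
  toℕ-iterate-next zero u _ = sym (+-identityʳ (toℕ u))
  toℕ-iterate-next (suc i) u lt = begin
    toℕ (iterate next (next u) i) ≡⟨ toℕ-iterate-next i (next u) (subst (λ t → t + i < 2 + m) (sym toℕ-next) lt′) ⟩
    toℕ (next u) + i              ≡⟨ cong (_+ i) toℕ-next ⟩
    suc (toℕ u) + i               ≡⟨ sym (+-suc (toℕ u) i) ⟩
    toℕ u + suc i                 ∎
    where
    open ≡-Reasoning
    lt′ : suc (toℕ u) + i < 2 + m
    lt′ = subst (_< 2 + m) (+-suc (toℕ u) i) lt
    toℕ-next : toℕ (next u) ≡ suc (toℕ u)
    toℕ-next = toℕ-CycStep (proj₂ (successor u)) (≤-trans (s≤s (m≤m+n (suc (toℕ u)) i)) lt′)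

  toℕ-iterate-prev : ∀ i u → i ≤ toℕ u → toℕ (iterate prev u i) + i ≡ toℕ u
  toℕ-iterate-prev zero u _ = +-identityʳ (toℕ u)
  toℕ-iterate-prev (suc i) u i<u = begin
    toℕ (iterate prev (prev u) i) + suc i   ≡⟨ +-suc _ i ⟩
    suc (toℕ (iterate prev (prev u) i) + i) ≡⟨ cong suc (toℕ-iterate-prev i (prev u) i≤prev) ⟩
    suc (toℕ (prev u))                      ≡⟨ toℕ-prev ⟩
    toℕ u                                   ∎
    where
    open ≡-Reasoning
    toℕ-prev : suc (toℕ (prev u)) ≡ toℕ u
    toℕ-prev = toℕ-CycStep⁻ (proj₂ (predecessor u)) (≤-trans z<s i<u)
    i≤prev : i ≤ toℕ (prev u)
    i≤prev = ≤-pred (subst (suc i ≤_) (sym toℕ-prev) i<u)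

  first-two : Subset (2 + m)
  first-two = ⁅ Fin.zero ⁆ ∪ ⁅ Fin.suc Fin.zero ⁆

  zero∈first-two : Fin.zero ∈ first-two
  zero∈first-two = x∈p∪q⁺ {p = ⁅ Fin.zero ⁆} {q = ⁅ Fin.suc Fin.zero ⁆} (inj₁ (x∈⁅x⁆ Fin.zero))

  one∈first-two : Fin.suc Fin.zero ∈ first-two
  one∈first-two = x∈p∪q⁺ {p = ⁅ Fin.zero ⁆} {q = ⁅ Fin.suc Fin.zero ⁆} (inj₂ (x∈⁅x⁆ (Fin.suc Fin.zero)))

  ∣first-two∣≡2 : ∣ first-two ∣ ≡ 2
  ∣first-two∣≡2 = ≤-antisym (∣⁅x⁆∪⁅y⁆∣≤2 {2 + m} Fin.zero (Fin.suc Fin.zero)) (x≢y⇒2≤∣p∣ zero∈first-two one∈first-two λ ())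

  next-zero : next Fin.zero ≡ Fin.suc Fin.zero
  next-zero = toℕ-injective (toℕ-CycStep (proj₂ (successor Fin.zero)) (s≤s (s≤s z≤n)))

  module _ {L : Subset (2 + m)} where

    Colored-forward : ∀ j v → toℕ v ≡ suc j → (∀ {w} → w ∈ L → ¬ (1 ≤ toℕ w × toℕ w ≤ j)) →
                      Colored (Cycle (2 + m)) L first-two v
    Colored-forward j v toℕv≡1+j unleaked =
      subst (Colored (Cycle (2 + m)) L first-two) reaches-v
        (Colored-iterate (Cycle (2 + m)) next prev adj-next adj⇒next⊎prev prev∘next
          j (init zero∈first-two) (init one∈first-two) unleaked-run)
      where
      index : ∀ {i} → i ≤ j → toℕ (iterate next (Fin.suc Fin.zero) i) ≡ suc i
      index {i} i≤j = toℕ-iterate-next i (Fin.suc Fin.zero)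
        (≤-trans (s≤s (s≤s i≤j)) (subst (_< 2 + m) toℕv≡1+j (toℕ<n v)))
      reaches-v : iterate next (Fin.suc Fin.zero) j ≡ v
      reaches-v = toℕ-injective (trans (index ≤-refl) (sym toℕv≡1+j))
      unleaked-run : ∀ {i} → i < j → iterate next (Fin.suc Fin.zero) i ∉ L
      unleaked-run i<j w∈L = unleaked w∈L
        (≤-trans z<s (≤-reflexive (sym (index (<⇒≤ i<j)))) , ≤-trans (≤-reflexive (index (<⇒≤ i<j))) i<j)

    Colored-backward : ∀ v → (∀ {w} → w ∈ L → 1 ≤ toℕ w × toℕ w ≤ toℕ v) →
                       Colored (Cycle (2 + m)) L first-two v
    Colored-backward v leaks-inside with m≤n⇒∃[o]m+o≡n (≤-pred (toℕ<n v))
    ... | d , toℕv+d≡1+m =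
      subst (Colored (Cycle (2 + m)) L first-two) reaches-v
        (Colored-iterate (Cycle (2 + m)) prev next adj-prev adj⇒prev⊎next next∘prev
          (suc d) (subst (Colored (Cycle (2 + m)) L first-two) (sym next-zero) (init one∈first-two))
          (init zero∈first-two) unleaked-run)
      where
      last : Fin (2 + m)
      last = prev Fin.zero
      index : ∀ {i} → i ≤ d → toℕ (iterate prev last i) + i ≡ toℕ v + d
      index {i} i≤d = trans (toℕ-iterate-prev i last i≤last) (trans (toℕ-fromℕ (suc m)) (sym toℕv+d≡1+m))
        where
        i≤last : i ≤ toℕ last
        i≤last = ≤-trans i≤d (≤-trans (m≤n+m d (toℕ v))
                   (≤-reflexive (trans toℕv+d≡1+m (sym (toℕ-fromℕ (suc m))))))
      reaches-v : iterate prev Fin.zero (suc d) ≡ v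
      reaches-v = toℕ-injective (+-cancelʳ-≡ d _ _ (index ≤-refl))
      unleaked-run : ∀ {i} → i < suc d → iterate prev Fin.zero i ∉ L
      unleaked-run {zero} _ zero∈L = contradiction (proj₁ (leaks-inside zero∈L)) λ ()
      unleaked-run {suc i} (s<s i<d) w∈L = contradiction (proj₂ (leaks-inside w∈L)) (<⇒≱ beyond-v)
        where
        beyond-v : toℕ v < toℕ (iterate prev last i)
        beyond-v = +-cancelʳ-< d _ _
          (subst (_< toℕ (iterate prev last i) + d) (index (<⇒≤ i<d)) (+-monoʳ-< _ i<d))

  -- The two routes to v = 1 + u pass through 1, …, u and through 0, n-1, …, v+1.
  Colored-first-two : ∀ {L} → ∣ L ∣ ≤ 1 → ∀ v → Colored (Cycle (2 + m)) L first-two v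
  Colored-first-two _ Fin.zero = init zero∈first-two
  Colored-first-two ∣L∣≤1 v@(Fin.suc u)
    with ∣p∣≤1⇒∀¬P⊎∀P (λ w → (1 ≤? toℕ w) ×-dec (toℕ w ≤? toℕ u)) ∣L∣≤1
  ... | inj₁ unleaked = Colored-forward (toℕ u) v refl unleaked
  ... | inj₂ leaks-inside = Colored-backward v λ w∈L →
          let (1≤w , w≤u) = leaks-inside w∈L in 1≤w , m≤n⇒m≤1+n w≤u

  Z-cycle≡2 : 3 ≤ 2 + m → ∀ {ℓ} → ℓ ≤ 1 → ZeroForcingℓ≡ (Cycle (2 + m)) ℓ 2
  Z-cycle≡2 3≤n ℓ≤1 =
    (first-two , (λ _ ∣L∣≤ℓ → Colored-first-two (≤-trans ∣L∣≤ℓ ℓ≤1)) , ∣first-two∣≡2) ,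
    λ _ → 2≤∣forcing-set∣ (Cycle (2 + m)) (cycle-two-neighbours 3≤n) {Fin.zero} {Fin.suc Fin.zero} λ ()

  Z-cycle≡n : ∀ {ℓ} → 2 ≤ ℓ → ZeroForcingℓ≡ (Cycle (2 + m)) ℓ (2 + m)
  Z-cycle≡n 2≤ℓ = Z≡n-if-neighbourhoods-≤ℓ (Cycle (2 + m)) λ v →
    ⁅ next v ⁆ ∪ ⁅ prev v ⁆ , ≤-trans (∣⁅x⁆∪⁅y⁆∣≤2 (next v) (prev v)) 2≤ℓ , adj⇒∈⁅next⁆∪⁅prev⁆

proposition12 : (n : ℕ) → n ≥ 3 →
    ((ℓ : ℕ) → ℓ ≤ 1 → ZeroForcingℓ≡ (Cycle n) ℓ 2) ×
    ((ℓ : ℕ) → ℓ ≥ 2 → ZeroForcingℓ≡ (Cycle n) ℓ n)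
proposition12 1 (s≤s ())
proposition12 (suc (suc m)) 3≤n = (λ _ → Z-cycle≡2 3≤n) , (λ _ → Z-cycle≡n)
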